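{- Let $G$ be a finite connected simple graph with $n$ vertices and $m$ edges, and let $k\ge 1$ be an integer. Then \[\Pi_2(S_k(G))=4^{km}\,\Pi_2(G).\]
   Context: For a graph $H$ and vertex $v$, $d_H(v)$ denotes the degree of $v$ in $H$. The second multiplicative Zagreb index is $\Pi_2(H)=\prod_{uv\in E(H)} d_H(u)d_H(v)$. The $k$-th subdivision graph $S_k(G)$ is the graph obtained from $G$ by inserting $k$ new vertices into each edge of $G$, i.e. each edge $uv$ of $G$ is replaced by a path from $u$ to $v$ with $k$ new internal vertices (distinct for distinct edges). -}

module Defs where

open import Data.Nat using (ℕ; _*_)
open import Data.Fin using (Fin)
open import Data.Nat.ListAction using (product)
open import Data.Fin.Properties using () renaming (_≟_ to _≟ᶠ_)
open import Data.List using (List; []; _∷_; _++_; [_]; length; filter; map; concatMap; lookup; allFin)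
open import Data.List.Relation.Unary.All using (All)
open import Data.List.Relation.Unary.AllPairs using (AllPairs)
open import Data.List.Membership.Propositional using (_∈_)
open import Data.Product using (_×_; _,_)
open import Data.Sum using (_⊎_; inj₁; inj₂)
import Data.Sum.Properties as SumP
import Data.Product.Properties as ProdP
open import Relation.Nullary using (¬_)
open import Relation.Nullary.Decidable using (_⊎-dec_)
open import Relation.Binary.Definitions using (DecidableEquality)
open import Relation.Binary.PropositionalEquality using (_≡_; _≢_)

-- A (finite) graph on vertex type V is given by its list of edges;
-- an edge (u , v) stands for the unordered edge {u, v}.

SameEdge : {V : Set} → V × V → V × V → Set
SameEdge (u , v) (x , y) = (u ≡ x × v ≡ y) ⊎ (u ≡ y × v ≡ x)

IsSimple : {V : Set} → List (V × V) → Set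
IsSimple E = All (λ { (u , v) → u ≢ v }) E × AllPairs (λ e f → ¬ SameEdge e f) E

data Reachable {V : Set} (E : List (V × V)) : V → V → Set where
  here  : ∀ {u} → Reachable E u u
  fwd   : ∀ {u v w} → (u , v) ∈ E → Reachable E v w → Reachable E u w
  bwd   : ∀ {u v w} → (v , u) ∈ E → Reachable E v w → Reachable E u w

Connected : {V : Set} → List (V × V) → Set
Connected {V} E = (u v : V) → Reachable E u v

deg : {V : Set} → DecidableEquality V → List (V × V) → V → ℕ
deg _≟_ E v = length (filter (λ { (a , b) → (v ≟ a) ⊎-dec (v ≟ b) }) E)

Π₂ : {V : Set} → DecidableEquality V → List (V × V) → ℕ
Π₂ _≟_ E = product (map (λ { (u , v) → deg _≟_ E u * deg _≟_ E v }) E)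

consecutive : {A : Set} → List A → List (A × A)
consecutive (x ∷ y ∷ r) = (x , y) ∷ consecutive (y ∷ r)
consecutive _ = []

-- vertices of the k-th subdivision graph: old vertices, plus k new
-- vertices (i , j), j < k, on the i-th edge
SubV : {V : Set} → ℕ → List (V × V) → Set
SubV {V} k E = V ⊎ (Fin (length E) × Fin k)

subdivide : {V : Set} → (k : ℕ) → (E : List (V × V)) → List (SubV k E × SubV k E)
subdivide k E = concatMap pathOf (allFin (length E))
  where
  pathOf : Fin (length E) → List (SubV k E × SubV k E)
  pathOf i with lookup E i
  ... | (u , v) = consecutive (inj₁ u ∷ (map (λ j → inj₂ (i , j)) (allFin k) ++ [ inj₁ v ]))

decSubV : {V : Set} → DecidableEquality V → (k : ℕ) → (E : List (V × V)) → DecidableEquality (SubV k E)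
decSubV _≟_ k E = SumP.≡-dec _≟_ (ProdP.≡-dec _≟ᶠ_ _≟ᶠ_)

decFin : (n : ℕ) → DecidableEquality (Fin n)
decFin n = _≟ᶠ_

-- In S_k(G) every edge uv of G becomes a path u, x₁, …, x_k, v.  An original
-- vertex keeps its degree (each incident edge still ends at it exactly once)
-- and every new vertex has degree 2.  Hence the path replacing uv contributes
-- d(u)·2 · (2·2)^(k-1) · 2·d(v) = 4^k d(u)d(v) to Π₂, and multiplying over the
-- m edges gives 4^(km) Π₂(G).
module Submission where

open import Defs
open import Data.Nat using (ℕ; zero; suc; _*_; _+_; _^_; _≤_)
open import Data.Nat.Properties using (+-identityʳ; +-assoc; ^-*-assoc)
open import Data.Nat.ListAction using (sum; product)
open import Data.Nat.ListAction.Properties using (product-++)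
open import Data.Bool using (true; false; if_then_else_; _∨_)
open import Data.Bool.Properties using (∨-identityʳ)
open import Data.Fin using (Fin; zero; suc)
open import Data.Fin.Properties using (0≢1+n; suc-injective)
open import Data.List using (List; []; _∷_; _++_; [_]; length; map; concatMap; lookup; allFin; tabulate)
open import Data.List.Properties using (map-++; map-cong; concatMap-cong; map-tabulate; tabulate-lookup)
open import Data.List.Relation.Unary.All using (All)
import Data.List.Relation.Unary.All as All
open import Data.List.Membership.Propositional.Properties using (∈-lookup)
open import Data.Product using (_×_; _,_; proj₁; proj₂)
open import Data.Sum using (inj₁; inj₂)
open import Data.Sum.Properties using (inj₁-injective; inj₂-injective)
open import Data.Product.Properties using (,-injectiveˡ; ,-injectiveʳ)
open import Function using (_∘_; id)
open import Function.Definitions using (Injective)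
open import Relation.Nullary using (does; yes; no)
open import Relation.Nullary.Decidable using (dec-true; dec-false)
open import Relation.Binary.Definitions using (DecidableEquality)
open import Relation.Binary.PropositionalEquality using (_≡_; _≢_; refl; sym; trans; cong; cong₂; module ≡-Reasoning)
open import Data.Nat.Solver using (module +-*-Solver)
open +-*-Solver using (solve; _:=_; _:*_; con)

path : {V : Set} {m : ℕ} → V → (Fin m → V) → V → List (V × V)
path a f b = consecutive (a ∷ tabulate f ++ [ b ])

map-lookup-allFin : {A B : Set} (g : A → B) (xs : List A) →
  map (g ∘ lookup xs) (allFin (length xs)) ≡ map g xs
map-lookup-allFin g xs = trans (map-tabulate id (g ∘ lookup xs))
  (trans (sym (map-tabulate (lookup xs) g)) (cong (map g) (tabulate-lookup xs)))

sum-tabulate-zero : ∀ {m} (F : Fin m → ℕ) → (∀ i → F i ≡ 0) → sum (tabulate F) ≡ 0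
sum-tabulate-zero {zero}  F F≡0 = refl
sum-tabulate-zero {suc m} F F≡0 = cong₂ _+_ (F≡0 zero) (sum-tabulate-zero (F ∘ suc) (F≡0 ∘ suc))

sum-tabulate-single : ∀ {m} (F : Fin m → ℕ) i → (∀ i′ → i′ ≢ i → F i′ ≡ 0) → sum (tabulate F) ≡ F i
sum-tabulate-single F zero F≡0 =
  trans (cong (F zero +_) (sum-tabulate-zero (F ∘ suc) (λ i → F≡0 (suc i) λ ())))
        (+-identityʳ (F zero))
sum-tabulate-single F (suc i) F≡0 =
  cong₂ _+_ (F≡0 zero λ ()) (sum-tabulate-single (F ∘ suc) i (λ i′ i′≢i → F≡0 (suc i′) (i′≢i ∘ suc-injective)))

product-map-scale : {A : Set} (c : ℕ) (F : A → ℕ) (xs : List A) →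
  product (map (λ x → c * F x) xs) ≡ c ^ length xs * product (map F xs)
product-map-scale c F []       = refl
product-map-scale c F (x ∷ xs) rewrite product-map-scale c F xs =
  solve 4 (λ c f l p → (c :* f) :* (l :* p) := (c :* l) :* (f :* p)) refl c (F x) (c ^ length xs) (product (map F xs))

product-map-concatMap : {A B : Set} (g : B → ℕ) (P : A → List B) (xs : List A) →
  product (map g (concatMap P xs)) ≡ product (map (λ x → product (map g (P x))) xs)
product-map-concatMap g P []       = refl
product-map-concatMap g P (x ∷ xs) =
  trans (cong product (map-++ g (P x) (concatMap P xs)))
    (trans (product-++ (map g (P x)) _) (cong (product (map g (P x)) *_) (product-map-concatMap g P xs)))

product-path : {V : Set} {m : ℕ} (h : V → ℕ) (a : V) (f : Fin m → V) (b : V) → (∀ j → h (f j) ≡ 2) →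
  product (map (λ (x , y) → h x * h y) (path a f b)) ≡ h a * 4 ^ m * h b
product-path {m = zero}  h a f b hf = solve 2 (λ x z → (x :* z) :* con 1 := x :* con 1 :* z) refl (h a) (h b)
product-path {m = suc m} h a f b hf rewrite product-path h (f zero) (f ∘ suc) b (hf ∘ suc) | hf zero =
  solve 3 (λ x y z → (x :* con 2) :* (con 2 :* y :* z) := x :* (con 4 :* y) :* z) refl (h a) (4 ^ m) (h b)

module Degree {V : Set} (_≟_ : DecidableEquality V) where

  δ : V → V → ℕ
  δ w x = if does (w ≟ x) then 1 else 0

  incidence : V → V × V → ℕ
  incidence w (x , y) = if does (w ≟ x) ∨ does (w ≟ y) then 1 else 0

  δ-refl : ∀ w → δ w w ≡ 1
  δ-refl w rewrite dec-true (w ≟ w) refl = refl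

  δ-≢ : ∀ {w x} → w ≢ x → δ w x ≡ 0
  δ-≢ {w} {x} w≢x rewrite dec-false (w ≟ x) w≢x = refl

  incidence-≢ˡ : ∀ {w x y} → w ≢ x → incidence w (x , y) ≡ δ w y
  incidence-≢ˡ {w} {x} w≢x rewrite dec-false (w ≟ x) w≢x = refl

  incidence-≢ʳ : ∀ {w x y} → w ≢ y → incidence w (x , y) ≡ δ w x
  incidence-≢ʳ {w} {x} {y} w≢y rewrite dec-false (w ≟ y) w≢y | ∨-identityʳ (does (w ≟ x)) = refl

  incidence-loopless : ∀ {w x y} → x ≢ y → incidence w (x , y) ≡ δ w x + δ w y
  incidence-loopless {w} {x} {y} x≢y with w ≟ x
  ... | no  _ = refl
  ... | yes refl rewrite dec-false (w ≟ y) x≢y = refl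

  deg-∷ : ∀ w e es → deg _≟_ (e ∷ es) w ≡ incidence w e + deg _≟_ es w
  deg-∷ w (x , y) es with does (w ≟ x) ∨ does (w ≟ y)
  ... | true  = refl
  ... | false = refl

  deg-sum : ∀ w es → deg _≟_ es w ≡ sum (map (incidence w) es)
  deg-sum w []       = refl
  deg-sum w (e ∷ es) = trans (deg-∷ w e es) (cong (incidence w e +_) (deg-sum w es))

  deg-++ : ∀ w es fs → deg _≟_ (es ++ fs) w ≡ deg _≟_ es w + deg _≟_ fs w
  deg-++ w []       fs = refl
  deg-++ w (e ∷ es) fs = begin
    deg _≟_ (e ∷ es ++ fs) w                      ≡⟨ deg-∷ w e (es ++ fs) ⟩
    incidence w e + deg _≟_ (es ++ fs) w          ≡⟨ cong (incidence w e +_) (deg-++ w es fs) ⟩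
    incidence w e + (deg _≟_ es w + deg _≟_ fs w) ≡⟨ sym (+-assoc (incidence w e) _ _) ⟩
    incidence w e + deg _≟_ es w + deg _≟_ fs w   ≡⟨ cong (_+ deg _≟_ fs w) (sym (deg-∷ w e es)) ⟩
    deg _≟_ (e ∷ es) w + deg _≟_ fs w             ∎
    where open ≡-Reasoning

  deg-concatMap : {A : Set} (P : A → List (V × V)) (w : V) (xs : List A) →
    deg _≟_ (concatMap P xs) w ≡ sum (map (λ x → deg _≟_ (P x) w) xs)
  deg-concatMap P w []       = refl
  deg-concatMap P w (x ∷ xs) =
    trans (deg-++ w (P x) (concatMap P xs)) (cong (deg _≟_ (P x) w +_) (deg-concatMap P w xs))

  deg-path-avoiding : ∀ {m} (a : V) (f : Fin m → V) b {w} → w ≢ a → (∀ j → w ≢ f j) →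
    deg _≟_ (path a f b) w ≡ δ w b
  deg-path-avoiding {zero} a f b {w} w≢a w∉f =
    trans (deg-∷ w (a , b) []) (trans (+-identityʳ _) (incidence-≢ˡ w≢a))
  deg-path-avoiding {suc m} a f b {w} w≢a w∉f =
    trans (deg-∷ w (a , f zero) _)
      (cong₂ _+_ (trans (incidence-≢ˡ w≢a) (δ-≢ (w∉f zero)))
                 (deg-path-avoiding (f zero) (f ∘ suc) b (w∉f zero) (w∉f ∘ suc)))

  deg-path-ends : ∀ {m} (a : V) (f : Fin m → V) b {w} → a ≢ b → (∀ j → w ≢ f j) →
    deg _≟_ (path a f b) w ≡ δ w a + δ w b
  deg-path-ends {zero} a f b {w} a≢b w∉f =
    trans (deg-∷ w (a , b) []) (trans (+-identityʳ _) (incidence-loopless a≢b))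
  deg-path-ends {suc m} a f b {w} a≢b w∉f =
    trans (deg-∷ w (a , f zero) _)
      (cong₂ _+_ (incidence-≢ʳ (w∉f zero))
                 (deg-path-avoiding (f zero) (f ∘ suc) b (w∉f zero) (w∉f ∘ suc)))

  deg-path-inner : ∀ {m} (a : V) (f : Fin m → V) b → Injective _≡_ _≡_ f → ∀ j → f j ≢ a → f j ≢ b →
    deg _≟_ (path a f b) (f j) ≡ 2
  deg-path-inner a f b f-inj zero f₀≢a f₀≢b = begin
    deg _≟_ (path a f b) (f zero)                                     ≡⟨ deg-∷ (f zero) (a , f zero) _ ⟩
    incidence (f zero) (a , f zero) + deg _≟_ (path (f zero) (f ∘ suc) b) (f zero)
      ≡⟨ cong₂ _+_ (incidence-≢ˡ f₀≢a) (deg-path-ends (f zero) (f ∘ suc) b f₀≢b (λ j → 0≢1+n ∘ f-inj)) ⟩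
    δ (f zero) (f zero) + (δ (f zero) (f zero) + δ (f zero) b)
      ≡⟨ cong₂ _+_ (δ-refl (f zero)) (cong₂ _+_ (δ-refl (f zero)) (δ-≢ f₀≢b)) ⟩
    2                                                                 ∎
    where open ≡-Reasoning
  deg-path-inner a f b f-inj (suc j) fⱼ≢a fⱼ≢b =
    trans (deg-∷ (f (suc j)) (a , f zero) _)
      (cong₂ _+_ (trans (incidence-≢ˡ fⱼ≢a) (δ-≢ fⱼ≢f₀))
                 (deg-path-inner (f zero) (f ∘ suc) b (suc-injective ∘ f-inj) j fⱼ≢f₀ fⱼ≢b))
    where
    fⱼ≢f₀ : f (suc j) ≢ f zero
    fⱼ≢f₀ = 0≢1+n ∘ sym ∘ f-inj

module Subdivision {V : Set} (_≟_ : DecidableEquality V) (E : List (V × V))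
                   (loopless : All (λ (u , v) → u ≢ v) E) (k : ℕ) where

  private
    N = length E
    W = SubV k E
    _≟ˢ_ = decSubV _≟_ k E
    S = subdivide k E
    module DV = Degree _≟_
    module DS = Degree _≟ˢ_

  u v : Fin N → V
  u i = proj₁ (lookup E i)
  v i = proj₂ (lookup E i)

  u≢v : ∀ i → u i ≢ v i
  u≢v i = All.lookup loopless (∈-lookup i)

  subdividedEdge : Fin N → List (W × W)
  subdividedEdge i = path (inj₁ (u i)) (λ j → inj₂ (i , j)) (inj₁ (v i))

  subdivide-≡ : S ≡ concatMap subdividedEdge (allFin N)
  subdivide-≡ = concatMap-cong
    (λ i → cong (λ js → consecutive (inj₁ (u i) ∷ js ++ [ inj₁ (v i) ])) (map-tabulate id (λ j → inj₂ (i , j))))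
    (allFin N)

  deg-subdividedEdge-old : ∀ i x → deg _≟ˢ_ (subdividedEdge i) (inj₁ x) ≡ DV.δ x (u i) + DV.δ x (v i)
  deg-subdividedEdge-old i x =
    DS.deg-path-ends (inj₁ (u i)) (λ j → inj₂ (i , j)) (inj₁ (v i)) (u≢v i ∘ inj₁-injective) (λ _ ())

  deg-subdividedEdge-new : ∀ i j → deg _≟ˢ_ (subdividedEdge i) (inj₂ (i , j)) ≡ 2
  deg-subdividedEdge-new i j =
    DS.deg-path-inner (inj₁ (u i)) (λ j → inj₂ (i , j)) (inj₁ (v i)) (,-injectiveʳ ∘ inj₂-injective) j (λ ()) (λ ())

  deg-subdividedEdge-other : ∀ {i′ i} j → i′ ≢ i → deg _≟ˢ_ (subdividedEdge i′) (inj₂ (i , j)) ≡ 0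
  deg-subdividedEdge-other {i′} j i′≢i =
    DS.deg-path-ends (inj₁ (u i′)) (λ j → inj₂ (i′ , j)) (inj₁ (v i′)) (u≢v i′ ∘ inj₁-injective)
      (λ j′ → i′≢i ∘ sym ∘ ,-injectiveˡ ∘ inj₂-injective)

  deg-subdivide-old : ∀ x → deg _≟ˢ_ S (inj₁ x) ≡ deg _≟_ E x
  deg-subdivide-old x = begin
    deg _≟ˢ_ S (inj₁ x)
      ≡⟨ cong (λ T → deg _≟ˢ_ T (inj₁ x)) subdivide-≡ ⟩
    deg _≟ˢ_ (concatMap subdividedEdge (allFin N)) (inj₁ x)
      ≡⟨ DS.deg-concatMap subdividedEdge (inj₁ x) (allFin N) ⟩
    sum (map (λ i → deg _≟ˢ_ (subdividedEdge i) (inj₁ x)) (allFin N))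
      ≡⟨ cong sum (map-cong (λ i → deg-subdividedEdge-old i x) (allFin N)) ⟩
    sum (map (λ i → DV.δ x (u i) + DV.δ x (v i)) (allFin N))
      ≡⟨ cong sum (map-cong (λ i → sym (DV.incidence-loopless (u≢v i))) (allFin N)) ⟩
    sum (map (DV.incidence x ∘ lookup E) (allFin N))
      ≡⟨ cong sum (map-lookup-allFin (DV.incidence x) E) ⟩
    sum (map (DV.incidence x) E)
      ≡⟨ sym (DV.deg-sum x E) ⟩
    deg _≟_ E x ∎
    where open ≡-Reasoning

  deg-subdivide-new : ∀ i j → deg _≟ˢ_ S (inj₂ (i , j)) ≡ 2
  deg-subdivide-new i j = begin
    deg _≟ˢ_ S (inj₂ (i , j))
      ≡⟨ cong (λ T → deg _≟ˢ_ T (inj₂ (i , j))) subdivide-≡ ⟩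
    deg _≟ˢ_ (concatMap subdividedEdge (allFin N)) (inj₂ (i , j))
      ≡⟨ DS.deg-concatMap subdividedEdge (inj₂ (i , j)) (allFin N) ⟩
    sum (map degAt (allFin N))
      ≡⟨ cong sum (map-tabulate id degAt) ⟩
    sum (tabulate degAt)
      ≡⟨ sum-tabulate-single degAt i (λ i′ → deg-subdividedEdge-other j) ⟩
    degAt i
      ≡⟨ deg-subdividedEdge-new i j ⟩
    2 ∎
    where
    open ≡-Reasoning
    degAt : Fin N → ℕ
    degAt i′ = deg _≟ˢ_ (subdividedEdge i′) (inj₂ (i , j))

  Π₂-subdivide : Π₂ _≟ˢ_ S ≡ 4 ^ (k * N) * Π₂ _≟_ E
  Π₂-subdivide = begin
    Π₂ _≟ˢ_ S
      ≡⟨ cong (product ∘ map weightˢ) subdivide-≡ ⟩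
    product (map weightˢ (concatMap subdividedEdge (allFin N)))
      ≡⟨ product-map-concatMap weightˢ subdividedEdge (allFin N) ⟩
    product (map (λ i → product (map weightˢ (subdividedEdge i))) (allFin N))
      ≡⟨ cong product (map-cong (λ i → product-path dˢ _ _ _ (deg-subdivide-new i)) (allFin N)) ⟩
    product (map (λ i → dˢ (inj₁ (u i)) * 4 ^ k * dˢ (inj₁ (v i))) (allFin N))
      ≡⟨ cong product (map-cong edgeFactor (allFin N)) ⟩
    product (map ((λ e → 4 ^ k * weight e) ∘ lookup E) (allFin N))
      ≡⟨ cong product (map-lookup-allFin (λ e → 4 ^ k * weight e) E) ⟩
    product (map (λ e → 4 ^ k * weight e) E)
      ≡⟨ product-map-scale (4 ^ k) weight E ⟩
    (4 ^ k) ^ N * Π₂ _≟_ E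
      ≡⟨ cong (_* Π₂ _≟_ E) (^-*-assoc 4 k N) ⟩
    4 ^ (k * N) * Π₂ _≟_ E ∎
    where
    open ≡-Reasoning
    dˢ : W → ℕ
    dˢ = deg _≟ˢ_ S
    weightˢ : W × W → ℕ
    weightˢ (x , y) = dˢ x * dˢ y
    weight : V × V → ℕ
    weight (x , y) = deg _≟_ E x * deg _≟_ E y
    edgeFactor : ∀ i → dˢ (inj₁ (u i)) * 4 ^ k * dˢ (inj₁ (v i)) ≡ 4 ^ k * weight (lookup E i)
    edgeFactor i rewrite deg-subdivide-old (u i) | deg-subdivide-old (v i) =
      solve 3 (λ a c b → a :* c :* b := c :* (a :* b)) refl (deg _≟_ E (u i)) (4 ^ k) (deg _≟_ E (v i))

theorem2p5 : (n : ℕ) (E : List (Fin n × Fin n)) → IsSimple E → Connected E →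
    (k : ℕ) → 1 ≤ k →
    Π₂ (decSubV (decFin n) k E) (subdivide k E) ≡ 4 ^ (k * length E) * Π₂ (decFin n) E
theorem2p5 n E (loopless , _) _ k _ = Subdivision.Π₂-subdivide (decFin n) E loopless k
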